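{- The Diophantine equation $x^2 = 57\cdot 2^{n} + 117440512$ has exactly six solutions $(x,n)$ in non-negative integers, namely \[ (x,n)=(10837, 0), (10880,14), (11008,16), (13312,20), (32768,24), (45056,25). \] Similarly, the Diophantine equation $x^2 = 165\cdot 2^{n} + 26404$ has exactly six solutions $(x,n)$ in non-negative integers, namely \[ (x,n)=(163,0), (178,5), (218,7), (262,8), (442,10), (838,12). \] -}

{-# OPTIONS --safe #-}
module Submission where

-- Both equations are settled by a direct search for small n and a congruence argument for large n.
--
-- Since 117440512 = 7 · 2²⁴, for n ≥ 26 the first equation says x² = 2²⁴ (4k + 3); then x = 2¹² y with
-- y² ≡ 3 (mod 4), which is impossible.
--
-- For n ≥ 16 the second equation reads Y² = 26404 + D W² with W = 2^⌊n/2⌋ ≥ 2⁸ and D = 165 or 330.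
-- Dividing Y + W √D by the fundamental unit a + b √D (1079 + 84 √165, resp. 109 + 6 √330) gives a
-- solution with a smaller W as long as W is above an explicit bound W₀, so every solution arises from
-- one with W < W₀ by repeatedly multiplying by the unit or its conjugate. Hence, modulo a suitable M, the
-- residues of all solutions lie in any finite set S that contains those of the solutions with W < W₀ and
-- is closed under both multiplications; S is found by computer and no element of it has as W-residue the
-- residue of a power 2ᵏ with k ≥ 7 (resp. k ≥ 5).

open import Data.Bool.Base using (Bool; T; _∧_; if_then_else_)
open import Data.Bool.ListAction using (any)
open import Data.Bool.Properties using (T-∧)
open import Data.Empty using (⊥; ⊥-elim)
open import Data.List.Base using (List; []; _∷_; upTo)
open import Data.List.Membership.Propositional using (_∈_)
open import Data.List.Membership.Propositional.Properties using (∈-upTo⁺)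
open import Data.List.Relation.Unary.All as All using (All; all?)
open import Data.List.Relation.Unary.Any as Any using (here; there)
open import Data.List.Relation.Unary.Any.Properties using (any⁺; any⁻)
open import Data.Nat.Base
open import Data.Nat.DivMod
  using (_/_; _%_; m%n<n; m%n≤n; m%n%n≡m%n; n%n≡0; m*n%n≡0; m≡m%n+[m/n]*n; %-distribˡ-+; %-distribˡ-*; [m+kn]%n≡m%n)
open import Data.Nat.Divisibility using (divides)
open import Data.Nat.Induction using (<-rec)
open import Data.Nat.Primality using (Prime; prime[2]; prime⇒nonZero; euclidsLemma)
open import Data.Nat.Properties
open import Data.List.Membership.DecPropositional _≟_ using () renaming (_∈_ to _∈ℕ_; _∈?_ to _∈ℕ?_)
open import Data.Nat.Tactic.RingSolver using (solve-∀; solve)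
open import Data.Product.Base using (∃-syntax; _×_; _,_; proj₁; proj₂)
open import Data.Sum.Base using (_⊎_; inj₁; inj₂; [_,_]′)
import Data.Sum.Base as Sum
open import Function.Base using (id; _∘_)
open import Function.Bundles using (_⇔_; mk⇔; Equivalence)
open import Relation.Binary.PropositionalEquality
open import Relation.Nullary.Decidable using (Dec; yes; no; True; toWitness; map′; T?; ¬?; _×-dec_; _⊎-dec_)
open import Relation.Nullary.Negation using (¬_; contradiction)
open import Relation.Unary using (Decidable)

-- Squares and square roots

square-≤-cancel : ∀ m n → m * m ≤ n * n → m ≤ n
square-≤-cancel m n m²≤n² with m ≤? n
... | yes m≤n = m≤n
... | no m≰n = contradiction m²≤n² (<⇒≱ (*-mono-< n<m n<m)) where n<m = ≰⇒> m≰n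

square-<-cancel : ∀ m n → m * m < n * n → m < n
square-<-cancel m n m²<n² with m <? n
... | yes m<n = m<n
... | no m≮n = contradiction m²<n² (≤⇒≯ (*-mono-≤ n≤m n≤m)) where n≤m = ≮⇒≥ m≮n

square-injective : ∀ m n → m * m ≡ n * n → m ≡ n
square-injective m n m²≡n² =
  ≤-antisym (square-≤-cancel m n (≤-reflexive m²≡n²)) (square-≤-cancel n m (≤-reflexive (sym m²≡n²)))

no-square-between : ∀ r x → r * r < x * x → x * x < suc r * suc r → ⊥
no-square-between r x r²<x² x²<[1+r]² =
  <⇒≱ (square-<-cancel x (suc r) x²<[1+r]²) (square-<-cancel r x r²<x²)

-- Binary search for ⌊√c⌋. Halving uses
-- _/_, which is evaluated by a builtin, unlike ⌊_/2⌋.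
isqrt : ℕ → ℕ
isqrt c = search 64 0 (suc c)
  where
  search : ℕ → ℕ → ℕ → ℕ
  search zero       lo hi = lo
  search (suc fuel) lo hi =
    if hi ≤ᵇ suc lo then lo
    else if mid * mid ≤ᵇ c then search fuel mid hi else search fuel lo mid
    where mid = (lo + hi) / 2

RootCertificate : (ℕ → Set) → ℕ → ℕ → Set
RootCertificate P c r = (r * r ≡ c × P r) ⊎ (r * r < c × c < suc r * suc r)

rootCertificate? : ∀ {P} → Decidable P → ∀ c r → Dec (RootCertificate P c r)
rootCertificate? P? c r = (r * r ≟ c ×-dec P? r) ⊎-dec (r * r <? c ×-dec c <? suc r * suc r)

rootCertificate-sound : ∀ {P c} r x → RootCertificate P c r → x * x ≡ c → P x
rootCertificate-sound {P} r x (inj₁ (r²≡c , Pr)) x²≡c =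
  subst P (square-injective r x (trans r²≡c (sym x²≡c))) Pr
rootCertificate-sound r x (inj₂ (r²<c , c<[1+r]²)) refl =
  ⊥-elim (no-square-between r x r²<c c<[1+r]²)

module _ {P : ℕ → ℕ → Set} (P? : ∀ n → Decidable (P n)) (f : ℕ → ℕ) where

  rootCertificatesBelow? : ∀ B → Dec (All (λ n → RootCertificate (P n) (f n) (isqrt (f n))) (upTo B))
  rootCertificatesBelow? B = all? (λ n → rootCertificate? (P? n) (f n) (isqrt (f n))) (upTo B)

  square-roots-below : ∀ B → True (rootCertificatesBelow? B) → ∀ {n} x → n < B → x * x ≡ f n → P n x
  square-roots-below B certified {n} x n<B =
    rootCertificate-sound {P n} (isqrt (f n)) x (All.lookup (toWitness certified) (∈-upTo⁺ n<B))

-- For a concrete list this reduces to the right-nested disjunction of the statement.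
OneOf : List (ℕ × ℕ) → ℕ → ℕ → Set
OneOf []                     x n = ⊥
OneOf ((p , q) ∷ [])         x n = x ≡ p × n ≡ q
OneOf ((p , q) ∷ ss@(_ ∷ _)) x n = (x ≡ p × n ≡ q) ⊎ OneOf ss x n

∈⇒OneOf : ∀ ss {x n} → (x , n) ∈ ss → OneOf ss x n
∈⇒OneOf (_ ∷ [])         (here refl) = refl , refl
∈⇒OneOf (_ ∷ _ ∷ _)      (here refl) = inj₁ (refl , refl)
∈⇒OneOf (_ ∷ ss@(_ ∷ _)) (there x∈)  = inj₂ (∈⇒OneOf ss x∈)

OneOf⇒∈ : ∀ ss {x n} → OneOf ss x n → (x , n) ∈ ss
OneOf⇒∈ (_ ∷ [])         (refl , refl)        = here refl
OneOf⇒∈ (_ ∷ _ ∷ _)      (inj₁ (refl , refl)) = here refl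
OneOf⇒∈ (_ ∷ ss@(_ ∷ _)) (inj₂ x∈)            = there (OneOf⇒∈ ss x∈)

solutions-characterised : ∀ (f : ℕ → ℕ) ss →
  (∀ x n → x * x ≡ f n → (x , n) ∈ ss) → All (λ (x , n) → x ^ 2 ≡ f n) ss →
  ∀ x n → (x ^ 2 ≡ f n) ⇔ OneOf ss x n
solutions-characterised f ss complete sound x n = mk⇔
  (λ x²≡fn → ∈⇒OneOf ss (complete x n (trans (sym x^2≡x*x) x²≡fn)))
  (λ listed → All.lookup sound (OneOf⇒∈ ss listed))
  where x^2≡x*x = cong (x *_) (*-identityʳ x)

-- Membership of pairs is decided by one boolean computation: deciding it through Dec-valued
-- equality tests makes checking the large certificates below exhaust memory.
_≡ᵇₚ_ : ℕ × ℕ → ℕ × ℕ → Bool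
(y , w) ≡ᵇₚ (y′ , w′) = (y ≡ᵇ y′) ∧ (w ≡ᵇ w′)

≡ᵇₚ⇒≡ : ∀ p q → T (p ≡ᵇₚ q) → p ≡ q
≡ᵇₚ⇒≡ (y , w) (y′ , w′) y≡y′∧w≡w′ =
  let y≡y′ , w≡w′ = Equivalence.to T-∧ y≡y′∧w≡w′ in cong₂ _,_ (≡ᵇ⇒≡ y y′ y≡y′) (≡ᵇ⇒≡ w w′ w≡w′)

≡ᵇₚ-refl : ∀ p → T (p ≡ᵇₚ p)
≡ᵇₚ-refl (y , w) = Equivalence.from T-∧ (≡⇒≡ᵇ y y refl , ≡⇒≡ᵇ w w refl)

_∈?_ : ∀ p S → Dec (p ∈ S)
p ∈? S = map′ (Any.map (≡ᵇₚ⇒≡ p _) ∘ any⁻ (p ≡ᵇₚ_) S)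
               (any⁺ (p ≡ᵇₚ_) ∘ Any.map (λ { refl → ≡ᵇₚ-refl p }))
               (T? (any (p ≡ᵇₚ_) S))

prime-square-divides : ∀ {p} → Prime p → ∀ x c → x * x ≡ p * p * c → ∃[ y ] x ≡ p * y × y * y ≡ c
prime-square-divides {p} p-prime x c x²≡p²c
  with divides y x≡yp ← [ id , id ]′ (euclidsLemma x x p-prime
         (divides (p * c) (trans x²≡p²c (trans (*-assoc p p c) (*-comm p (p * c))))))
  = y , x≡py , *-cancelˡ-≡ (y * y) c (p * p) (begin
      p * p * (y * y)   ≡⟨ square-of-product p y ⟩
      (p * y) * (p * y) ≡⟨ cong₂ _*_ x≡py x≡py ⟨
      x * x             ≡⟨ x²≡p²c ⟩
      p * p * c         ∎)
  where
  instance
    p≢0 : NonZero p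
    p≢0 = prime⇒nonZero p-prime
    p²≢0 : NonZero (p * p)
    p²≢0 = m*n≢0 p p
  open ≡-Reasoning
  square-of-product : ∀ p y → p * p * (y * y) ≡ (p * y) * (p * y)
  square-of-product = solve-∀
  x≡py : x ≡ p * y
  x≡py = trans x≡yp (*-comm y p)

prime-power-square-divides : ∀ {p} → Prime p → ∀ j x c →
  x * x ≡ p ^ j * p ^ j * c → ∃[ y ] x ≡ p ^ j * y × y * y ≡ c
prime-power-square-divides p-prime zero x c x²≡c =
  x , sym (*-identityˡ x) , trans x²≡c (*-identityˡ c)
prime-power-square-divides {p} p-prime (suc j) x c x²≡p²ʲ⁺²c =
  let y₁ , x≡py₁ , y₁²≡p²ʲc = prime-square-divides p-prime x _ (trans x²≡p²ʲ⁺²c (regroup p (p ^ j) c))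
      y  , y₁≡pʲy , y²≡c   = prime-power-square-divides p-prime j y₁ c y₁²≡p²ʲc
  in y , trans x≡py₁ (trans (cong (p *_) y₁≡pʲy) (sym (*-assoc p (p ^ j) y))) , y²≡c
  where
  regroup : ∀ p q c → p * q * (p * q) * c ≡ p * p * (q * q * c)
  regroup = solve-∀

square≢3+k*4 : ∀ y k → y * y ≢ 3 + k * 4
square≢3+k*4 y k y²≡3+4k = residue (y % 4) (m%n<n y 4) (begin
  (y % 4 * (y % 4)) % 4 ≡⟨ %-distribˡ-* y y 4 ⟨
  (y * y) % 4           ≡⟨ cong (_% 4) y²≡3+4k ⟩
  (3 + k * 4) % 4       ≡⟨ [m+kn]%n≡m%n 3 k 4 ⟩
  3                     ∎)
  where
  open ≡-Reasoning
  residue : ∀ r → r < 4 → (r * r) % 4 ≢ 3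
  residue 0 _ ()
  residue 1 _ ()
  residue 2 _ ()
  residue 3 _ ()
  residue (suc (suc (suc (suc _)))) (s≤s (s≤s (s≤s (s≤s ()))))

power-of-two-split : ∀ n → 2 ^ n ≡ 2 ^ ⌊ n /2⌋ * 2 ^ ⌊ n /2⌋ ⊎ 2 ^ n ≡ 2 * (2 ^ ⌊ n /2⌋ * 2 ^ ⌊ n /2⌋)
power-of-two-split 0             = inj₁ refl
power-of-two-split 1             = inj₂ refl
power-of-two-split (suc (suc n)) = Sum.map
  (λ 2ⁿ≡P² → trans (cong (λ t → 2 * (2 * t)) 2ⁿ≡P²) (double (2 ^ ⌊ n /2⌋)))
  (λ 2ⁿ≡2P² → trans (cong (λ t → 2 * (2 * t)) 2ⁿ≡2P²) (cong (2 *_) (double (2 ^ ⌊ n /2⌋))))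
  (power-of-two-split n)
  where
  double : ∀ P → 2 * (2 * (P * P)) ≡ 2 * P * (2 * P)
  double = solve-∀

-- Residues modulo M

module Modular (M : ℕ) .{{_ : NonZero M}} where

  +-cong-% : ∀ {m m′ n n′} → m % M ≡ m′ % M → n % M ≡ n′ % M → (m + n) % M ≡ (m′ + n′) % M
  +-cong-% {m} {m′} {n} {n′} m≈m′ n≈n′ = begin
    (m + n) % M             ≡⟨ %-distribˡ-+ m n M ⟩
    (m % M + n % M) % M     ≡⟨ cong₂ (λ s t → (s + t) % M) m≈m′ n≈n′ ⟩
    (m′ % M + n′ % M) % M   ≡⟨ %-distribˡ-+ m′ n′ M ⟨
    (m′ + n′) % M           ∎
    where open ≡-Reasoning

  *-congˡ-% : ∀ k {n n′} → n % M ≡ n′ % M → (k * n) % M ≡ (k * n′) % M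
  *-congˡ-% k {n} {n′} n≈n′ = begin
    (k * n) % M             ≡⟨ %-distribˡ-* k n M ⟩
    (k % M * (n % M)) % M   ≡⟨ cong (λ t → (k % M * t) % M) n≈n′ ⟩
    (k % M * (n′ % M)) % M  ≡⟨ %-distribˡ-* k n′ M ⟨
    (k * n′) % M            ∎
    where open ≡-Reasoning

  linear-% : ∀ k l y w → (k * y + l * w) % M ≡ (k * (y % M) + l * (w % M)) % M
  linear-% k l y w = +-cong-% (*-congˡ-% k (sym (m%n%n≡m%n y M))) (*-congˡ-% l (sym (m%n%n≡m%n w M)))

  -- The additive inverse of a residue r < M, represented by M rather than 0 when r = 0.
  negate : ℕ → ℕ
  negate r = M ∸ r

  +-negate : ∀ w → (w + negate (w % M)) % M ≡ 0
  +-negate w = begin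
    (w + (M ∸ w % M)) % M                     ≡⟨ cong (λ t → (t + (M ∸ w % M)) % M) (m≡m%n+[m/n]*n w M) ⟩
    (w % M + w / M * M + (M ∸ w % M)) % M     ≡⟨ cong (_% M) (swap (w % M) (w / M * M) (M ∸ w % M)) ⟩
    (w % M + (M ∸ w % M) + w / M * M) % M     ≡⟨ cong (λ t → (t + w / M * M) % M) (m+[n∸m]≡n (m%n≤n w M)) ⟩
    (M + w / M * M) % M                       ≡⟨ [m+kn]%n≡m%n M (w / M) M ⟩
    M % M                                     ≡⟨ n%n≡0 M ⟩
    0                                         ∎
    where
    open ≡-Reasoning
    swap : ∀ p q r → p + q + r ≡ p + r + q
    swap = solve-∀

  powers-within : ∀ g t (L : List ℕ) → (g ^ t) % M ∈ℕ L → (∀ {r} → r ∈ℕ L → (g * r) % M ∈ℕ L) →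
                  ∀ k → t ≤ k → (g ^ k) % M ∈ℕ L
  powers-within g t L gᵗ∈L closed k t≤k =
    let j , t+j≡k = m≤n⇒∃[o]m+o≡n t≤k in subst (λ k → (g ^ k) % M ∈ℕ L) t+j≡k (orbit j)
    where
    orbit : ∀ j → (g ^ (t + j)) % M ∈ℕ L
    orbit zero    = subst (λ k → (g ^ k) % M ∈ℕ L) (sym (+-identityʳ t)) gᵗ∈L
    orbit (suc j) = subst (λ k → (g ^ k) % M ∈ℕ L) (sym (+-suc t j))
      (subst (_∈ℕ L) (*-congˡ-% g (m%n%n≡m%n (g ^ (t + j)) M)) (closed (orbit j)))

-- Descent for Y² = N + D W²

square≡suc : ∀ n m → n * n ≡ suc m → ∃[ k ] n ≡ suc k × k * k ≤ m
square≡suc (suc k) m n²≡1+m = k , refl , (begin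
  k * k           ≤⟨ *-monoʳ-≤ k (n≤1+n k) ⟩
  k * suc k       ≤⟨ m≤n+m (k * suc k) k ⟩
  k + k * suc k   ≡⟨ suc-injective n²≡1+m ⟩
  m               ∎)
  where open ≤-Reasoning

module PellDescent (D a b N : ℕ) (unit : a * a ≡ 1 + D * (b * b)) where

  Solution : ℕ → ℕ → Set
  Solution Y W = Y * Y ≡ N + D * (W * W)

  -- (Y , W) is the image of (Y′ , W′), resp. of (Y′ , -W′), under multiplication by a + b √D.
  Image⁺ Image⁻ : ℕ → ℕ → ℕ → ℕ → Set
  Image⁺ Y W Y′ W′ = Y ≡ a * Y′ + D * b * W′ × W ≡ b * Y′ + a * W′
  Image⁻ Y W Y′ W′ = a * Y′ ≡ Y + D * b * W′ × b * Y′ ≡ W + a * W′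

  data Descent (Y W : ℕ) : Set where
    descent⁺ : ∀ {Y′ W′} → W′ < W → Solution Y′ W′ → Image⁺ Y W Y′ W′ → Descent Y W
    descent⁻ : ∀ {Y′ W′} → W′ < W → Solution Y′ W′ → Image⁻ Y W Y′ W′ → Descent Y W

  unit-expand : ∀ X → a * (a * X) ≡ X + D * (b * b) * X
  unit-expand X = trans (sym (*-assoc a a X)) (cong (_* X) unit)

  inverse⁺ : ∀ {Y W Y′ W′} → D * b * W + Y′ ≡ a * Y → b * Y + W′ ≡ a * W → Image⁺ Y W Y′ W′
  inverse⁺ {Y} {W} {Y′} {W′} eY eW =
    +-cancelʳ-≡ (D * (b * b) * Y) Y (a * Y′ + D * b * W′) (begin
      Y + D * (b * b) * Y            ≡⟨ unit-expand Y ⟨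
      a * (a * Y)                    ≡⟨ cong (a *_) eY ⟨
      a * (D * b * W + Y′)           ≡⟨ solve (a ∷ D ∷ b ∷ W ∷ Y′ ∷ []) ⟩
      D * b * (a * W) + a * Y′       ≡⟨ cong (λ t → D * b * t + a * Y′) eW ⟨
      D * b * (b * Y + W′) + a * Y′  ≡⟨ solve (a ∷ D ∷ b ∷ Y ∷ W′ ∷ Y′ ∷ []) ⟩
      a * Y′ + D * b * W′ + D * (b * b) * Y ∎) ,
    +-cancelʳ-≡ (D * (b * b) * W) W (b * Y′ + a * W′) (begin
      W + D * (b * b) * W            ≡⟨ unit-expand W ⟨
      a * (a * W)                    ≡⟨ cong (a *_) eW ⟨
      a * (b * Y + W′)               ≡⟨ solve (a ∷ b ∷ Y ∷ W′ ∷ []) ⟩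
      b * (a * Y) + a * W′           ≡⟨ cong (λ t → b * t + a * W′) eY ⟨
      b * (D * b * W + Y′) + a * W′  ≡⟨ solve (a ∷ D ∷ b ∷ W ∷ Y′ ∷ W′ ∷ []) ⟩
      b * Y′ + a * W′ + D * (b * b) * W ∎)
    where open ≡-Reasoning

  inverse⁻ : ∀ {Y W Y′ W′} → D * b * W + Y′ ≡ a * Y → a * W + W′ ≡ b * Y → Image⁻ Y W Y′ W′
  inverse⁻ {Y} {W} {Y′} {W′} eY eW =
    +-cancelʳ-≡ (D * b * (a * W)) (a * Y′) (Y + D * b * W′) (begin
      a * Y′ + D * b * (a * W)       ≡⟨ solve (a ∷ D ∷ b ∷ W ∷ Y′ ∷ []) ⟩
      a * (D * b * W + Y′)           ≡⟨ cong (a *_) eY ⟩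
      a * (a * Y)                    ≡⟨ unit-expand Y ⟩
      Y + D * (b * b) * Y            ≡⟨ solve (Y ∷ D ∷ b ∷ []) ⟩
      Y + D * b * (b * Y)            ≡⟨ cong (λ t → Y + D * b * t) eW ⟨
      Y + D * b * (a * W + W′)       ≡⟨ solve (Y ∷ D ∷ b ∷ a ∷ W ∷ W′ ∷ []) ⟩
      Y + D * b * W′ + D * b * (a * W) ∎) ,
    +-cancelʳ-≡ (D * (b * b) * W) (b * Y′) (W + a * W′) (begin
      b * Y′ + D * (b * b) * W       ≡⟨ solve (b ∷ Y′ ∷ D ∷ W ∷ []) ⟩
      b * (D * b * W + Y′)           ≡⟨ cong (b *_) eY ⟩
      b * (a * Y)                    ≡⟨ solve (b ∷ a ∷ Y ∷ []) ⟩
      a * (b * Y)                    ≡⟨ cong (a *_) eW ⟨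
      a * (a * W + W′)               ≡⟨ solve (a ∷ W ∷ W′ ∷ []) ⟩
      a * (a * W) + a * W′           ≡⟨ cong (_+ a * W′) (unit-expand W) ⟩
      W + D * (b * b) * W + a * W′   ≡⟨ solve (W ∷ D ∷ b ∷ a ∷ W′ ∷ []) ⟩
      W + a * W′ + D * (b * b) * W   ∎)
    where open ≡-Reasoning

  solution⁺ : ∀ {Y W Y′ W′} → Image⁺ Y W Y′ W′ → Solution Y W → Solution Y′ W′
  solution⁺ {Y′ = y} {W′ = w} (refl , refl) sol = +-cancelʳ-≡ K (y * y) (N + D * (w * w)) (begin
    y * y + K                                                       ≡⟨ +-assoc (y * y) (D * (b * b) * (y * y)) L ⟨
    y * y + D * (b * b) * (y * y) + L                               ≡⟨ cong (_+ L) (unit-expand (y * y)) ⟨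
    a * (a * (y * y)) + L                                           ≡⟨ brahmagupta a b D y w ⟩
    (a * y + D * b * w) * (a * y + D * b * w) + D * (b * b) * (y * y) + D * (a * (a * (w * w)))
      ≡⟨ cong₂ (λ s t → s + D * (b * b) * (y * y) + D * t) sol (unit-expand (w * w)) ⟩
    N + D * (W * W) + D * (b * b) * (y * y) + D * (w * w + D * (b * b) * (w * w))
      ≡⟨ regroup N D b y w (W * W) ⟩
    N + D * (w * w) + K                                             ∎)
    where
    open ≡-Reasoning
    W = b * y + a * w
    L = D * (W * W) + D * (D * (b * b)) * (w * w)
    K = D * (b * b) * (y * y) + L
    -- Brahmagupta's identity, with the negative terms moved to the other side
    brahmagupta : ∀ a b D y w →
      a * (a * (y * y)) + (D * ((b * y + a * w) * (b * y + a * w)) + D * (D * (b * b)) * (w * w)) ≡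
      (a * y + D * b * w) * (a * y + D * b * w) + D * (b * b) * (y * y) + D * (a * (a * (w * w)))
    brahmagupta = solve-∀
    regroup : ∀ N D b y w V →
      N + D * V + D * (b * b) * (y * y) + D * (w * w + D * (b * b) * (w * w)) ≡
      N + D * (w * w) + (D * (b * b) * (y * y) + (D * V + D * (D * (b * b)) * (w * w)))
    regroup = solve-∀

  solution⁻ : ∀ {Y W Y′ W′} → D * b * W + Y′ ≡ a * Y → a * W + W′ ≡ b * Y → b * Y′ ≡ W + a * W′ →
              Solution Y W → Solution Y′ W′
  solution⁻ {Y} {W} {Y′} {W′} eY eW eW′ sol = +-cancelʳ-≡ K (Y′ * Y′) (N + D * (W′ * W′)) (begin
    Y′ * Y′ + (2 * D * W * (W + a * W′) + D * (D * (b * b)) * (W * W))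
      ≡⟨ cong (λ t → Y′ * Y′ + (2 * D * W * t + D * (D * (b * b)) * (W * W))) eW′ ⟨
    Y′ * Y′ + (2 * D * W * (b * Y′) + D * (D * (b * b)) * (W * W))
      ≡⟨ solve (Y′ ∷ D ∷ W ∷ b ∷ []) ⟩
    (D * b * W + Y′) * (D * b * W + Y′)         ≡⟨ cong (λ t → t * t) eY ⟩
    a * Y * (a * Y)                             ≡⟨ solve (a ∷ Y ∷ []) ⟩
    a * (a * (Y * Y))                           ≡⟨ unit-expand (Y * Y) ⟩
    Y * Y + D * (b * b) * (Y * Y)               ≡⟨ solve (Y ∷ D ∷ b ∷ []) ⟩
    Y * Y + D * (b * Y * (b * Y))               ≡⟨ cong₂ (λ s t → s + D * (t * t)) sol (sym eW) ⟩
    N + D * (W * W) + D * ((a * W + W′) * (a * W + W′))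
      ≡⟨ solve (N ∷ D ∷ W ∷ a ∷ W′ ∷ []) ⟩
    N + D * (W * W) + D * (a * (a * (W * W))) + 2 * D * a * W * W′ + D * (W′ * W′)
      ≡⟨ cong (λ t → N + D * (W * W) + D * t + 2 * D * a * W * W′ + D * (W′ * W′)) (unit-expand (W * W)) ⟩
    N + D * (W * W) + D * (W * W + D * (b * b) * (W * W)) + 2 * D * a * W * W′ + D * (W′ * W′)
      ≡⟨ solve (N ∷ D ∷ W ∷ b ∷ a ∷ W′ ∷ []) ⟩
    N + D * (W′ * W′) + (2 * D * W * (W + a * W′) + D * (D * (b * b)) * (W * W)) ∎)
    where
    open ≡-Reasoning
    K = 2 * D * W * (W + a * W′) + D * (D * (b * b)) * (W * W)

  Db-W≤a-Y : ∀ {Y W} → Solution Y W → D * b * W ≤ a * Y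
  Db-W≤a-Y {Y} {W} sol = square-≤-cancel (D * b * W) (a * Y) (begin
    D * b * W * (D * b * W)            ≡⟨ solve (D ∷ b ∷ W ∷ []) ⟩
    D * (D * (b * b)) * (W * W)        ≤⟨ *-monoˡ-≤ (W * W) (*-monoʳ-≤ D Db²≤a²) ⟩
    D * (a * a) * (W * W)              ≤⟨ m≤n+m (D * (a * a) * (W * W)) (a * a * N) ⟩
    a * a * N + D * (a * a) * (W * W)  ≡⟨ solve (a ∷ N ∷ D ∷ W ∷ []) ⟩
    a * a * (N + D * (W * W))          ≡⟨ cong (a * a *_) sol ⟨
    a * a * (Y * Y)                    ≡⟨ solve (a ∷ Y ∷ []) ⟩
    a * Y * (a * Y)                    ∎)
    where
    open ≤-Reasoning
    Db²≤a² : D * (b * b) ≤ a * a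
    Db²≤a² = subst (D * (b * b) ≤_) (sym unit) (n≤1+n _)

  shrinks⁺ : ∀ {Y W W′} → 0 < b * b * N → Solution Y W → b * Y + W′ ≡ a * W → W′ < W
  shrinks⁺ {Y} {W} {W′} 0<b²N sol eW
    with a₁ , a≡1+a₁ , a₁²≤Db² ← square≡suc a (D * (b * b)) unit
    = +-cancelˡ-< (b * Y) W′ W (begin-strict
        b * Y + W′   ≡⟨ trans eW (cong (_* W) a≡1+a₁) ⟩
        W + a₁ * W   <⟨ +-monoʳ-< W (square-<-cancel (a₁ * W) (b * Y) (begin-strict
          a₁ * W * (a₁ * W)                  ≡⟨ solve (a₁ ∷ W ∷ []) ⟩
          a₁ * a₁ * (W * W)                  ≤⟨ *-monoˡ-≤ (W * W) a₁²≤Db² ⟩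
          D * (b * b) * (W * W)              <⟨ m<n+m (D * (b * b) * (W * W)) 0<b²N ⟩
          b * b * N + D * (b * b) * (W * W)  ≡⟨ solve (b ∷ N ∷ D ∷ W ∷ []) ⟩
          b * b * (N + D * (W * W))          ≡⟨ cong (b * b *_) sol ⟨
          b * b * (Y * Y)                    ≡⟨ solve (b ∷ Y ∷ []) ⟩
          b * Y * (b * Y)                    ∎)) ⟩
        W + b * Y    ≡⟨ +-comm W (b * Y) ⟩
        b * Y + W    ∎)
    where open ≤-Reasoning

  shrinks⁻ : ∀ {Y W W′} → b * b * N < (2 * a + 2) * (W * W) → Solution Y W → a * W + W′ ≡ b * Y → W′ < W
  shrinks⁻ {Y} {W} {W′} W-large sol eW = +-cancelˡ-< (a * W) W′ W (begin-strict
    a * W + W′   ≡⟨ eW ⟩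
    b * Y        <⟨ square-<-cancel (b * Y) ((1 + a) * W) (begin-strict
      b * Y * (b * Y)                                ≡⟨ solve (b ∷ Y ∷ []) ⟩
      b * b * (Y * Y)                                ≡⟨ cong (b * b *_) sol ⟩
      b * b * (N + D * (W * W))                      ≡⟨ solve (b ∷ N ∷ D ∷ W ∷ []) ⟩
      b * b * N + D * (b * b) * (W * W)              <⟨ +-monoˡ-< (D * (b * b) * (W * W)) W-large ⟩
      (2 * a + 2) * (W * W) + D * (b * b) * (W * W)  ≡⟨ solve (a ∷ W ∷ D ∷ b ∷ []) ⟩
      (2 * a + 1 + (1 + D * (b * b))) * (W * W)      ≡⟨ cong (λ t → (2 * a + 1 + t) * (W * W)) unit ⟨
      (2 * a + 1 + a * a) * (W * W)                  ≡⟨ solve (a ∷ W ∷ []) ⟩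
      (1 + a) * W * ((1 + a) * W)                    ∎) ⟩
    W + a * W    ≡⟨ +-comm W (a * W) ⟩
    a * W + W    ∎)
    where open ≤-Reasoning

  descent : ∀ {Y W} → 0 < b * b * N → b * b * N < (2 * a + 2) * (W * W) → Solution Y W → Descent Y W
  descent {Y} {W} 0<b²N W-large sol
    with Y′ , eY ← m≤n⇒∃[o]m+o≡n (Db-W≤a-Y sol) | b * Y ≤? a * W
  ... | yes bY≤aW =
    let W′ , eW = m≤n⇒∃[o]m+o≡n bY≤aW
    in descent⁺ (shrinks⁺ 0<b²N sol eW) (solution⁺ (inverse⁺ eY eW) sol) (inverse⁺ eY eW)
  ... | no bY≰aW =
    let W′ , eW = m≤n⇒∃[o]m+o≡n (<⇒≤ (≰⇒> bY≰aW))
    in descent⁻ (shrinks⁻ W-large sol eW) (solution⁻ eY eW (proj₂ (inverse⁻ eY eW)) sol) (inverse⁻ eY eW)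

  module Residues (M : ℕ) .{{_ : NonZero M}} where
    open Modular M

    timesUnit : ℕ × ℕ → ℕ × ℕ
    timesUnit (y , w) = ((a * y + D * b * w) % M , (b * y + a * w) % M)

    conj : ℕ × ℕ → ℕ × ℕ
    conj (y , w) = (y , negate w)

    Closed : List (ℕ × ℕ) → Set
    Closed S = All (λ p → timesUnit p ∈ S × timesUnit (conj p) ∈ S) S

    closed? : Decidable Closed
    closed? S = all? (λ p → timesUnit p ∈? S ×-dec timesUnit (conj p) ∈? S) S

    image⁺-residues : ∀ {Y W Y′ W′} → Image⁺ Y W Y′ W′ → (Y % M , W % M) ≡ timesUnit (Y′ % M , W′ % M)
    image⁺-residues {Y′ = Y′} {W′} (refl , refl) = cong₂ _,_ (linear-% a (D * b) Y′ W′) (linear-% b a Y′ W′)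

    image⁻-residues : ∀ {Y W Y′ W′} → Image⁻ Y W Y′ W′ → (Y % M , W % M) ≡ timesUnit (conj (Y′ % M , W′ % M))
    image⁻-residues (eY , eW) = cong₂ _,_ (sym (residue⁻ a (D * b) eY)) (sym (residue⁻ b a eW))
      where
      residue⁻ : ∀ k l {Z Y′ W′} → k * Y′ ≡ Z + l * W′ → (k * (Y′ % M) + l * negate (W′ % M)) % M ≡ Z % M
      residue⁻ k l {Z} {Y′} {W′} eq = begin
        (k * (Y′ % M) + l * negate (W′ % M)) % M  ≡⟨ +-cong-% (*-congˡ-% k (m%n%n≡m%n Y′ M)) refl ⟩
        (k * Y′ + l * negate (W′ % M)) % M        ≡⟨ cong (λ t → (t + l * negate (W′ % M)) % M) eq ⟩
        (Z + l * W′ + l * negate (W′ % M)) % M    ≡⟨ cong (_% M) (distrib Z l W′ (negate (W′ % M))) ⟩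
        (Z + l * (W′ + negate (W′ % M))) % M      ≡⟨ +-cong-% {Z} refl (*-congˡ-% l (trans (+-negate W′) (sym (m*n%n≡0 0 M)))) ⟩
        (Z + l * 0) % M                           ≡⟨ cong (λ t → (Z + t) % M) (*-zeroʳ l) ⟩
        (Z + 0) % M                               ≡⟨ cong (_% M) (+-identityʳ Z) ⟩
        Z % M                                     ∎
        where
        open ≡-Reasoning
        distrib : ∀ z l w v → z + l * w + l * v ≡ z + l * (w + v)
        distrib = solve-∀

    module Invariant
      (S : List (ℕ × ℕ)) (closed : Closed S)
      (W₀ : ℕ) (0<b²N : 0 < b * b * N) (W₀-large : b * b * N < (2 * a + 2) * (W₀ * W₀))
      (small : ∀ {W} Y → W < W₀ → Solution Y W → (Y % M , W % M) ∈ S) where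

      residues-of-solutions : ∀ {W} Y → Solution Y W → (Y % M , W % M) ∈ S
      residues-of-solutions {W} = <-rec (λ W → ∀ Y → Solution Y W → (Y % M , W % M) ∈ S) step W
        where
        step : ∀ W → (∀ {W′} → W′ < W → ∀ Y′ → Solution Y′ W′ → (Y′ % M , W′ % M) ∈ S) →
               ∀ Y → Solution Y W → (Y % M , W % M) ∈ S
        step W IH Y sol with W <? W₀
        ... | yes W<W₀ = small Y W<W₀ sol
        ... | no W≮W₀ with descent 0<b²N W-large sol
          where
          W₀≤W = ≮⇒≥ W≮W₀
          W-large = <-≤-trans W₀-large (*-monoʳ-≤ (2 * a + 2) (*-mono-≤ W₀≤W W₀≤W))
        ...   | descent⁺ W′<W sol′ image =
          subst (_∈ S) (sym (image⁺-residues image)) (proj₁ (All.lookup closed (IH W′<W _ sol′)))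
        ...   | descent⁻ W′<W sol′ image =
          subst (_∈ S) (sym (image⁻-residues image)) (proj₂ (All.lookup closed (IH W′<W _ sol′)))

      no-solution-at-powers : ∀ (L : List ℕ) g t → All (λ (_ , w) → ¬ w ∈ℕ L) S →
        (g ^ t) % M ∈ℕ L → (∀ {r} → r ∈ℕ L → (g * r) % M ∈ℕ L) → ∀ Y k → t ≤ k → ¬ Solution Y (g ^ k)
      no-solution-at-powers L g t disjoint gᵗ∈L closedL Y k t≤k sol =
        All.lookup disjoint (residues-of-solutions Y sol) (powers-within g t L gᵗ∈L closedL k t≤k)

-- The first equation

solutions₁ : List (ℕ × ℕ)
solutions₁ = (10837 , 0) ∷ (10880 , 14) ∷ (11008 , 16) ∷ (13312 , 20) ∷ (32768 , 24) ∷ (45056 , 25) ∷ []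

-- Implicit arguments next to large literals are given explicitly here and below: solving them by
-- unification unfolds the literals in unary.
equation₁-rhs-factorised : ∀ m → 57 * 2 ^ (26 + m) + 117440512 ≡ 2 ^ 12 * 2 ^ 12 * (3 + (57 * 2 ^ m + 1) * 4)
equation₁-rhs-factorised m = begin
  57 * 2 ^ (26 + m) + 117440512
    ≡⟨ cong (λ t → 57 * t + 117440512) {2 ^ (26 + m)} {2 ^ 26 * 2 ^ m} (^-distribˡ-+-* 2 26 m) ⟩
  57 * (2 ^ 26 * 2 ^ m) + 117440512
    ≡⟨ cong₂ (λ s t → 57 * (s * 2 ^ m) + t) {2 ^ 26} {A * A * 4} {117440512} {A * A * 7} refl refl ⟩
  57 * (A * A * 4 * 2 ^ m) + A * A * 7
    ≡⟨ factor 57 A (2 ^ m) ⟩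
  A * A * (3 + (57 * 2 ^ m + 1) * 4) ∎
  where
  open ≡-Reasoning
  A = 2 ^ 12
  factor : ∀ k A P → k * (A * A * 4 * P) + A * A * 7 ≡ A * A * (3 + (k * P + 1) * 4)
  factor = solve-∀

equation₁-no-large-solution : ∀ x m → x * x ≢ 57 * 2 ^ (26 + m) + 117440512
equation₁-no-large-solution x m x²≡rhs =
  let y , _ , y²≡3+k*4 =
        prime-power-square-divides prime[2] 12 x (3 + k * 4) (trans x²≡rhs (equation₁-rhs-factorised m))
  in square≢3+k*4 y k y²≡3+k*4
  where k = 57 * 2 ^ m + 1

equation₁-complete : ∀ x n → x * x ≡ 57 * 2 ^ n + 117440512 → (x , n) ∈ solutions₁
equation₁-complete x n x²≡rhs with n <? 26
... | yes n<26 =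
  square-roots-below (λ n x → (x , n) ∈? solutions₁) (λ n → 57 * 2 ^ n + 117440512) 26 _ x n<26 x²≡rhs
... | no n≮26 =
  let m , 26+m≡n = m≤n⇒∃[o]m+o≡n (≮⇒≥ n≮26)
  in contradiction x²≡rhs
       (subst (λ n → x * x ≢ 57 * 2 ^ n + 117440512) 26+m≡n (equation₁-no-large-solution x m))

-- The second equation

solutions₂ : List (ℕ × ℕ)
solutions₂ = (163 , 0) ∷ (178 , 5) ∷ (218 , 7) ∷ (262 , 8) ∷ (442 , 10) ∷ (838 , 12) ∷ []

-- Certificates, found by computer search: S contains the residues modulo M of the solutions of
-- Y² = 26404 + D W² with W < W₀ and is closed under multiplication by the unit and its conjugate;
-- L consists of the residues of 2ᵏ for k ≥ 7 (resp. k ≥ 5).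
S₁₆₅ : List (ℕ × ℕ)
S₁₆₅ = (163 , 1) ∷ (163 , 738175) ∷ (167 , 3) ∷ (167 , 738173) ∷ (233 , 13) ∷ (233 , 738163) ∷ (262 , 16) ∷ (262 , 738160) ∷ (383 , 27) ∷ (383 , 738149) ∷ (442 , 32) ∷ (442 , 738144) ∷ (838 , 64) ∷ (838 , 738112) ∷ (977 , 75) ∷ (977 , 738101) ∷ (1142 , 88) ∷ (1142 , 738088) ∷ (1333 , 103) ∷ (1333 , 738073) ∷ (2587 , 201) ∷ (2587 , 737975) ∷ (3023 , 235) ∷ (3023 , 737941) ∷ (3177 , 179443) ∷ (3177 , 558733) ∷ (3925 , 366023) ∷ (3925 , 372153) ∷ (4717 , 367) ∷ (4717 , 737809) ∷ (5513 , 429) ∷ (5513 , 737747) ∷ (7245 , 52879) ∷ (7245 , 685297) ∷ (8391 , 188381) ∷ (8391 , 549795) ∷ (10727 , 835) ∷ (10727 , 737341) ∷ (12538 , 976) ∷ (12538 , 737200) ∷ (14683 , 1143) ∷ (14683 , 737033) ∷ (14805 , 256071) ∷ (14805 , 482105) ∷ (17162 , 1336) ∷ (17162 , 736840) ∷ (19338 , 350568) ∷ (19338 , 387608) ∷ (21879 , 240173) ∷ (21879 , 498003) ∷ (26673 , 315285) ∷ (26673 , 422891) ∷ (28277 , 90535) ∷ (28277 , 647641) ∷ (28307 , 233745) ∷ (28307 , 504431) ∷ (29313 , 340635) ∷ (29313 , 397541) ∷ (30743 , 94195) ∷ (30743 , 643981) ∷ (31307 , 147047) ∷ (31307 , 591129)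 ∷ (32221 , 233087) ∷ (32221 , 505089) ∷ (33398 , 2600) ∷ (33398 , 735576) ∷ (39037 , 3039) ∷ (39037 , 735137) ∷ (40913 , 65099) ∷ (40913 , 673077) ∷ (42521 , 222787) ∷ (42521 , 515389) ∷ (49301 , 61305) ∷ (49301 , 676871) ∷ (53961 , 240621) ∷ (53961 , 497555) ∷ (56585 , 235181) ∷ (56585 , 502995) ∷ (57713 , 39509) ∷ (57713 , 698667) ∷ (57871 , 132395) ∷ (57871 , 605781) ∷ (59002 , 38352) ∷ (59002 , 699824) ∷ (59755 , 314247) ∷ (59755 , 423929) ∷ (60938 , 4744) ∷ (60938 , 733432) ∷ (61046 , 195448) ∷ (61046 , 542728) ∷ (62499 , 335489) ∷ (62499 , 402687) ∷ (63703 , 229965) ∷ (63703 , 508211) ∷ (65290 , 333608) ∷ (65290 , 404568) ∷ (68346 , 227952) ∷ (68346 , 510224) ∷ (71227 , 5545) ∷ (71227 , 732631) ∷ (75607 , 111693) ∷ (75607 , 626483) ∷ (75635 , 139087) ∷ (75635 , 599089) ∷ (82219 , 205127) ∷ (82219 , 533049) ∷ (83651 , 187807) ∷ (83651 , 550369) ∷ (89399 , 85395) ∷ (89399 , 652781) ∷ (89590 , 128072) ∷ (89590 , 610104) ∷ (92609 , 28837) ∷ (92609 , 709339) ∷ (93831 , 162659) ∷ (93831 , 575517) ∷ (94278 , 247680) ∷ (94278 , 490496) ∷ (96423 , 163837) ∷ (96423 , 574339) ∷ (97663 , 359141) ∷ (97663 , 379035) ∷ (106187 , 275431) ∷ (106187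 , 462745) ∷ (107510 , 169768) ∷ (107510 , 568408) ∷ (108022 , 255016) ∷ (108022 , 483160) ∷ (108537 , 227043) ∷ (108537 , 511133) ∷ (108614 , 96896) ∷ (108614 , 641280) ∷ (109045 , 335655) ∷ (109045 , 402521) ∷ (109959 , 86429) ∷ (109959 , 651747) ∷ (110265 , 267171) ∷ (110265 , 471005) ∷ (113631 , 340091) ∷ (113631 , 398085) ∷ (116982 , 162616) ∷ (116982 , 575560) ∷ (117958 , 363200) ∷ (117958 , 374976) ∷ (121413 , 270551) ∷ (121413 , 467625) ∷ (125958 , 69552) ∷ (125958 , 668624) ∷ (129273 , 82077) ∷ (129273 , 656099) ∷ (133691 , 234839) ∷ (133691 , 503337) ∷ (134885 , 49975) ∷ (134885 , 688201) ∷ (136175 , 249717) ∷ (136175 , 488459) ∷ (138613 , 10791) ∷ (138613 , 727385) ∷ (138835 , 15057) ∷ (138835 , 723119) ∷ (139327 , 344357) ∷ (139327 , 393819) ∷ (143123 , 132625) ∷ (143123 , 605551) ∷ (144285 , 178367) ∷ (144285 , 559809) ∷ (150859 , 360857) ∷ (150859 , 377319) ∷ (151273 , 291853) ∷ (151273 , 446323) ∷ (151434 , 244824) ∷ (151434 , 493352) ∷ (154969 , 135805) ∷ (154969 , 602371) ∷ (155489 , 203707) ∷ (155489 , 534469) ∷ (157825 , 14491) ∷ (157825 , 723685) ∷ (160729 , 2045) ∷ (160729 , 736131) ∷ (161567 , 329403) ∷ (161567 , 408773) ∷ (162017 , 12613) ∷ (162017 , 725563) ∷ (163629 , 298031) ∷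 (163629 , 440145) ∷ (165407 , 334651) ∷ (165407 , 403525) ∷ (167025 , 155307) ∷ (167025 , 582869) ∷ (172177 , 219787) ∷ (172177 , 518389) ∷ (172335 , 22603) ∷ (172335 , 715573) ∷ (175245 , 7375) ∷ (175245 , 730801) ∷ (177773 , 323217) ∷ (177773 , 414959) ∷ (182262 , 71656) ∷ (182262 , 666520) ∷ (184074 , 173576) ∷ (184074 , 564600) ∷ (189737 , 14771) ∷ (189737 , 723405) ∷ (193606 , 50272) ∷ (193606 , 687904) ∷ (199443 , 353809) ∷ (199443 , 384367) ∷ (201914 , 6976) ∷ (201914 , 731200) ∷ (204995 , 264863) ∷ (204995 , 473313) ∷ (208571 , 288471) ∷ (208571 , 449705) ∷ (210887 , 315043) ∷ (210887 , 423133) ∷ (214237 , 78721) ∷ (214237 , 659455) ∷ (220069 , 258551) ∷ (220069 , 479625) ∷ (220406 , 184952) ∷ (220406 , 553224) ∷ (221773 , 17265) ∷ (221773 , 720911) ∷ (225761 , 90299) ∷ (225761 , 647877) ∷ (226109 , 151327) ∷ (226109 , 586849) ∷ (226186 , 342936) ∷ (226186 , 395240) ∷ (227925 , 231367) ∷ (227925 , 506809) ∷ (228543 , 94629) ∷ (228543 , 643547) ∷ (229867 , 140039) ∷ (229867 , 598137) ∷ (234769 , 258165) ∷ (234769 , 480011) ∷ (235389 , 127649) ∷ (235389 , 610527) ∷ (237370 , 190880) ∷ (237370 , 547296) ∷ (238647 , 314605) ∷ (238647 , 423571) ∷ (244421 , 138409) ∷ (244421 , 599767) ∷ (244919 ,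 147565) ∷ (244919 , 590611) ∷ (246538 , 54824) ∷ (246538 , 683352) ∷ (247919 , 349067) ∷ (247919 , 389109) ∷ (248243 , 206095) ∷ (248243 , 532081) ∷ (250255 , 209237) ∷ (250255 , 528939) ∷ (252022 , 167112) ∷ (252022 , 571064) ∷ (254863 , 11221) ∷ (254863 , 726955) ∷ (258693 , 73833) ∷ (258693 , 664343) ∷ (262643 , 108751) ∷ (262643 , 629425) ∷ (264077 , 325681) ∷ (264077 , 412495) ∷ (265445 , 355657) ∷ (265445 , 382519) ∷ (269450 , 227592) ∷ (269450 , 510584) ∷ (270685 , 251521) ∷ (270685 , 486655) ∷ (271227 , 114665) ∷ (271227 , 623511) ∷ (275193 , 107747) ∷ (275193 , 630429) ∷ (281387 , 175417) ∷ (281387 , 562759) ∷ (282271 , 145979) ∷ (282271 , 592197) ∷ (292275 , 104975) ∷ (292275 , 633201) ∷ (300209 , 347755) ∷ (300209 , 390421) ∷ (310243 , 49983) ∷ (310243 , 688193) ∷ (312457 , 116947) ∷ (312457 , 621229) ∷ (312663 , 265907) ∷ (312663 , 472269) ∷ (312835 , 83423) ∷ (312835 , 654753) ∷ (314890 , 139448) ∷ (314890 , 598728) ∷ (322221 , 237359) ∷ (322221 , 500817) ∷ (323201 , 52325) ∷ (323201 , 685851) ∷ (325189 , 80169) ∷ (325189 , 658007) ∷ (326282 , 202504) ∷ (326282 , 535672) ∷ (329767 , 87293) ∷ (329767 , 650883) ∷ (332251 , 127241) ∷ (332251 , 610935) ∷ (333859 , 235263) ∷ (333859 , 502913) ∷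 (344673 , 100027) ∷ (344673 , 638149) ∷ (348005 , 329801) ∷ (348005 , 408375) ∷ (348227 , 151839) ∷ (348227 , 586337) ∷ (349211 , 57527) ∷ (349211 , 680649) ∷ (350859 , 49497) ∷ (350859 , 688679) ∷ (361789 , 314593) ∷ (361789 , 423583) ∷ (364655 , 293877) ∷ (364655 , 444299) ∷ (367610 , 190576) ∷ (367610 , 547600) ∷ (367833 , 313475) ∷ (367833 , 424701) ∷ (369251 , 369087) ∷ (369251 , 369089) ∷ (369255 , 369085) ∷ (369255 , 369091) ∷ (369321 , 369075) ∷ (369321 , 369101) ∷ (369471 , 369061) ∷ (369471 , 369115) ∷ (370065 , 369013) ∷ (370065 , 369163) ∷ (370421 , 368985) ∷ (370421 , 369191) ∷ (371675 , 368887) ∷ (371675 , 369289) ∷ (372111 , 368853) ∷ (372111 , 369323) ∷ (372265 , 189645) ∷ (372265 , 548531) ∷ (373013 , 3065) ∷ (373013 , 735111) ∷ (373805 , 368721) ∷ (373805 , 369455) ∷ (374601 , 368659) ∷ (374601 , 369517) ∷ (375930 , 195984) ∷ (375930 , 542192) ∷ (376333 , 316209) ∷ (376333 , 421967) ∷ (377479 , 180707) ∷ (377479 , 557469) ∷ (379815 , 368253) ∷ (379815 , 369923) ∷ (383771 , 367945) ∷ (383771 , 370231) ∷ (383893 , 113017) ∷ (383893 , 625159) ∷ (390967 , 128915) ∷ (390967 , 609261) ∷ (394822 , 273376) ∷ (394822 , 464800) ∷ (395761 , 53803) ∷ (395761 , 684373) ∷ (397365 , 278553) ∷ (397365 ,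 459623) ∷ (397395 , 135343) ∷ (397395 , 602833) ∷ (398401 , 28453) ∷ (398401 , 709723) ∷ (399831 , 274893) ∷ (399831 , 463283) ∷ (400395 , 222041) ∷ (400395 , 516135) ∷ (401309 , 136001) ∷ (401309 , 602175) ∷ (408125 , 366049) ∷ (408125 , 372127) ∷ (409862 , 247088) ∷ (409862 , 491088) ∷ (410001 , 303989) ∷ (410001 , 434187) ∷ (411609 , 146301) ∷ (411609 , 591875) ∷ (418389 , 307783) ∷ (418389 , 430393) ∷ (423049 , 128467) ∷ (423049 , 609709) ∷ (425673 , 133907) ∷ (425673 , 604269) ∷ (426801 , 329579) ∷ (426801 , 408597) ∷ (426959 , 236693) ∷ (426959 , 501483) ∷ (428843 , 54841) ∷ (428843 , 683335) ∷ (430266 , 60704) ∷ (430266 , 677472) ∷ (431587 , 33599) ∷ (431587 , 704577) ∷ (432791 , 139123) ∷ (432791 , 599053) ∷ (434310 , 8816) ∷ (434310 , 729360) ∷ (440310 , 294424) ∷ (440310 , 443752) ∷ (440315 , 363543) ∷ (440315 , 374633) ∷ (444695 , 257395) ∷ (444695 , 480781) ∷ (444723 , 230001) ∷ (444723 , 508175) ∷ (448774 , 154192) ∷ (448774 , 583984) ∷ (451307 , 163961) ∷ (451307 , 574215) ∷ (452739 , 181281) ∷ (452739 , 556895) ∷ (458487 , 283693) ∷ (458487 , 454483) ∷ (461697 , 340251) ∷ (461697 , 397925) ∷ (462919 , 206429) ∷ (462919 , 531747) ∷ (465511 , 205251) ∷ (465511 , 532925) ∷ (466751 , 9947) ∷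 (466751 , 728229) ∷ (469370 , 294576) ∷ (469370 , 443600) ∷ (475275 , 93657) ∷ (475275 , 644519) ∷ (477625 , 142045) ∷ (477625 , 596131) ∷ (478133 , 33433) ∷ (478133 , 704743) ∷ (478918 , 343456) ∷ (478918 , 394720) ∷ (479047 , 282659) ∷ (479047 , 455517) ∷ (479353 , 101917) ∷ (479353 , 636259) ∷ (481526 , 108232) ∷ (481526 , 629944) ∷ (482719 , 28997) ∷ (482719 , 709179) ∷ (490501 , 98537) ∷ (490501 , 639639) ∷ (498361 , 287011) ∷ (498361 , 451165) ∷ (502779 , 134249) ∷ (502779 , 603927) ∷ (503973 , 319113) ∷ (503973 , 419063) ∷ (504458 , 39272) ∷ (504458 , 698904) ∷ (505263 , 119371) ∷ (505263 , 618805) ∷ (506938 , 302016) ∷ (506938 , 436160) ∷ (507701 , 358297) ∷ (507701 , 379879) ∷ (507923 , 354031) ∷ (507923 , 384145) ∷ (508415 , 24731) ∷ (508415 , 713445) ∷ (512211 , 236463) ∷ (512211 , 501713) ∷ (513373 , 190721) ∷ (513373 , 547455) ∷ (519286 , 226328) ∷ (519286 , 511848) ∷ (519947 , 8231) ∷ (519947 , 729945) ∷ (520361 , 77235) ∷ (520361 , 660941) ∷ (524057 , 233283) ∷ (524057 , 504893) ∷ (524577 , 165381) ∷ (524577 , 572795) ∷ (526214 , 93456) ∷ (526214 , 644720) ∷ (526913 , 354597) ∷ (526913 , 383579) ∷ (527034 , 345056) ∷ (527034 , 393120) ∷ (527226 , 284752) ∷ (527226 , 453424) ∷ (529817 ,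 367043) ∷ (529817 , 371133) ∷ (530655 , 39685) ∷ (530655 , 698491) ∷ (531105 , 356475) ∷ (531105 , 381701) ∷ (532717 , 71057) ∷ (532717 , 667119) ∷ (534495 , 34437) ∷ (534495 , 703739) ∷ (536113 , 213781) ∷ (536113 , 524395) ∷ (541265 , 149301) ∷ (541265 , 588875) ∷ (541423 , 346485) ∷ (541423 , 391691) ∷ (544333 , 361713) ∷ (544333 , 376463) ∷ (546861 , 45871) ∷ (546861 , 692305) ∷ (548678 , 141280) ∷ (548678 , 596896) ∷ (558825 , 354317) ∷ (558825 , 383859) ∷ (568531 , 15279) ∷ (568531 , 722897) ∷ (570634 , 345896) ∷ (570634 , 392280) ∷ (574083 , 104225) ∷ (574083 , 633951) ∷ (577659 , 80617) ∷ (577659 , 657559) ∷ (579975 , 54045) ∷ (579975 , 684131) ∷ (583325 , 290367) ∷ (583325 , 447809) ∷ (589157 , 110537) ∷ (589157 , 627639) ∷ (590861 , 351823) ∷ (590861 , 386353) ∷ (594849 , 278789) ∷ (594849 , 459387) ∷ (595197 , 217761) ∷ (595197 , 520415) ∷ (597013 , 137721) ∷ (597013 , 600455) ∷ (597631 , 274459) ∷ (597631 , 463717) ∷ (598955 , 229049) ∷ (598955 , 509127) ∷ (603857 , 110923) ∷ (603857 , 627253) ∷ (604477 , 241439) ∷ (604477 , 496737) ∷ (607735 , 54483) ∷ (607735 , 683693) ∷ (611322 , 354832) ∷ (611322 , 383344) ∷ (613050 , 315392) ∷ (613050 , 422784) ∷ (613509 , 230679) ∷ (613509 , 507497) ∷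 (614007 , 221523) ∷ (614007 , 516653) ∷ (617007 , 20021) ∷ (617007 , 718155) ∷ (617331 , 162993) ∷ (617331 , 575183) ∷ (619343 , 159851) ∷ (619343 , 578325) ∷ (623951 , 357867) ∷ (623951 , 380309) ∷ (627781 , 295255) ∷ (627781 , 442921) ∷ (631731 , 260337) ∷ (631731 , 477839) ∷ (633165 , 43407) ∷ (633165 , 694769) ∷ (634533 , 13431) ∷ (634533 , 724745) ∷ (639773 , 117567) ∷ (639773 , 620609) ∷ (640266 , 233528) ∷ (640266 , 504648) ∷ (640315 , 254423) ∷ (640315 , 483753) ∷ (644281 , 261341) ∷ (644281 , 476835) ∷ (644470 , 311944) ∷ (644470 , 426232) ∷ (650475 , 193671) ∷ (650475 , 544505) ∷ (651359 , 223109) ∷ (651359 , 515067) ∷ (661363 , 264113) ∷ (661363 , 474063) ∷ (667018 , 358504) ∷ (667018 , 379672) ∷ (668278 , 167288) ∷ (668278 , 570888) ∷ (669297 , 21333) ∷ (669297 , 716843) ∷ (679331 , 319105) ∷ (679331 , 419071) ∷ (681545 , 252141) ∷ (681545 , 486035) ∷ (681751 , 103181) ∷ (681751 , 634995) ∷ (681923 , 285665) ∷ (681923 , 452511) ∷ (687350 , 16744) ∷ (687350 , 721432) ∷ (691309 , 131729) ∷ (691309 , 606447) ∷ (692289 , 316763) ∷ (692289 , 421413) ∷ (694277 , 288919) ∷ (694277 , 449257) ∷ (698855 , 281795) ∷ (698855 , 456381) ∷ (701339 , 241847) ∷ (701339 , 496329) ∷ (702947 , 133825) ∷ (702947 ,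 604351) ∷ (712506 , 269312) ∷ (712506 , 468864) ∷ (713761 , 269061) ∷ (713761 , 469115) ∷ (717093 , 39287) ∷ (717093 , 698889) ∷ (717315 , 217249) ∷ (717315 , 520927) ∷ (718299 , 311561) ∷ (718299 , 426615) ∷ (718730 , 347336) ∷ (718730 , 390840) ∷ (719947 , 319591) ∷ (719947 , 418585) ∷ (730877 , 54495) ∷ (730877 , 683681) ∷ (731782 , 60752) ∷ (731782 , 677424) ∷ (733743 , 75211) ∷ (733743 , 662965) ∷ (736902 , 168720) ∷ (736902 , 569456) ∷ (736921 , 55613) ∷ (736921 , 682563) ∷ []

L₁₆₅ : List ℕ
L₁₆₅ = 128 ∷ 256 ∷ 512 ∷ 1024 ∷ 2048 ∷ 4096 ∷ 7040 ∷ 8192 ∷ 13440 ∷ 14080 ∷ 16384 ∷ 26880 ∷ 28160 ∷ 32768 ∷ 36224 ∷ 46976 ∷ 53760 ∷ 56320 ∷ 65536 ∷ 72448 ∷ 73600 ∷ 92288 ∷ 93952 ∷ 103808 ∷ 107520 ∷ 112256 ∷ 112640 ∷ 121984 ∷ 129664 ∷ 131072 ∷ 135552 ∷ 140672 ∷ 144896 ∷ 147200 ∷ 159872 ∷ 162944 ∷ 178560 ∷ 184576 ∷ 187904 ∷ 207616 ∷ 212608 ∷ 215040 ∷ 216960 ∷ 224512 ∷ 225280 ∷ 237696 ∷ 243968 ∷ 259328 ∷ 262144 ∷ 268672 ∷ 271104 ∷ 281344 ∷ 289792 ∷ 293760 ∷ 294400 ∷ 299136 ∷ 310400 ∷ 319744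 ∷ 325888 ∷ 327552 ∷ 336512 ∷ 343424 ∷ 346240 ∷ 355200 ∷ 357120 ∷ 369152 ∷ 372608 ∷ 375808 ∷ 387200 ∷ 392576 ∷ 405888 ∷ 415232 ∷ 420992 ∷ 425216 ∷ 430080 ∷ 433920 ∷ 436864 ∷ 439424 ∷ 449024 ∷ 450560 ∷ 458368 ∷ 475392 ∷ 477568 ∷ 487936 ∷ 503424 ∷ 515968 ∷ 518656 ∷ 524288 ∷ 532864 ∷ 537344 ∷ 540800 ∷ 542208 ∷ 546688 ∷ 555392 ∷ 562688 ∷ 565376 ∷ 572032 ∷ 579584 ∷ 587520 ∷ 588800 ∷ 598272 ∷ 607872 ∷ 620800 ∷ 627072 ∷ 635520 ∷ 639488 ∷ 642432 ∷ 646784 ∷ 651776 ∷ 655104 ∷ 673024 ∷ 682624 ∷ 686848 ∷ 690304 ∷ 692480 ∷ 710400 ∷ 714240 ∷ []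

S₃₃₀ : List (ℕ × ℕ)
S₃₃₀ = (38 , 1736) ∷ (38 , 1880) ∷ (46 , 1196) ∷ (46 , 2420) ∷ (166 , 208) ∷ (166 , 3408) ∷ (178 , 4) ∷ (178 , 900) ∷ (178 , 2716) ∷ (178 , 3612) ∷ (218 , 8) ∷ (218 , 912) ∷ (218 , 2704) ∷ (218 , 3608) ∷ (250 , 1208) ∷ (250 , 1504) ∷ (250 , 2112) ∷ (250 , 2408) ∷ (262 , 1312) ∷ (262 , 2304) ∷ (274 , 4) ∷ (274 , 900) ∷ (274 , 2716) ∷ (274 , 3612) ∷ (314 , 1040) ∷ (314 , 1672) ∷ (314 , 1944) ∷ (314 , 2576) ∷ (358 , 464) ∷ (358 , 3152) ∷ (398 , 20) ∷ (398 , 3596) ∷ (466 , 1188) ∷ (466 , 1524) ∷ (466 , 2092) ∷ (466 , 2428) ∷ (558 , 1292) ∷ (558 , 2324) ∷ (626 , 372) ∷ (626 , 1276) ∷ (626 , 2340) ∷ (626 , 3244) ∷ (634 , 632) ∷ (634 , 1536) ∷ (634 , 2080) ∷ (634 , 2984) ∷ (690 , 436) ∷ (690 , 468) ∷ (690 , 3148) ∷ (690 , 3180) ∷ (718 , 1308) ∷ (718 , 2308) ∷ (998 , 464) ∷ (998 , 3152) ∷ (1070 , 1148) ∷ (1070 , 2468) ∷ (1094 , 1312) ∷ (1094 , 2304) ∷ (1102 , 60) ∷ (1102 , 3556) ∷ (1190 , 208) ∷ (1190 , 3408) ∷ (1318 , 72) ∷ (1318 , 3544) ∷ (1390 , 1316)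 ∷ (1390 , 2300) ∷ (1542 , 856) ∷ (1542 , 2760) ∷ (1626 , 1176) ∷ (1626 , 1536) ∷ (1626 , 2080) ∷ (1626 , 2440) ∷ (1774 , 412) ∷ (1774 , 3204) ∷ (1798 , 88) ∷ (1798 , 3528) ∷ (1862 , 1376) ∷ (1862 , 2240) ∷ (1946 , 136) ∷ (1946 , 1040) ∷ (1946 , 2576) ∷ (1946 , 3480) ∷ (2010 , 600) ∷ (2010 , 1504) ∷ (2010 , 2112) ∷ (2010 , 3016) ∷ (2042 , 912) ∷ (2042 , 1800) ∷ (2042 , 1816) ∷ (2042 , 2704) ∷ (2062 , 964) ∷ (2062 , 2652) ∷ (2094 , 1564) ∷ (2094 , 2052) ∷ (2342 , 616) ∷ (2342 , 3000) ∷ (2446 , 1404) ∷ (2446 , 2212) ∷ (2606 , 1420) ∷ (2606 , 2196) ∷ (2630 , 1192) ∷ (2630 , 2424) ∷ (2766 , 884) ∷ (2766 , 2732) ∷ (3110 , 1376) ∷ (3110 , 2240) ∷ (3118 , 1516) ∷ (3118 , 2100) ∷ (3174 , 1720) ∷ (3174 , 1896) ∷ (3246 , 1644) ∷ (3246 , 1972) ∷ (3378 , 436) ∷ (3378 , 468) ∷ (3378 , 3148) ∷ (3378 , 3180) ∷ (3430 , 952) ∷ (3430 , 2664) ∷ (3442 , 532) ∷ (3442 , 1436) ∷ (3442 , 2180) ∷ (3442 , 3084) ∷ (3534 , 1068) ∷ (3534 , 2548) ∷ (3602 , 284) ∷ (3602 , 620) ∷ (3602 , 2996) ∷ (3602 ,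 3332) ∷ []

L₃₃₀ : List ℕ
L₃₃₀ = 32 ∷ 64 ∷ 128 ∷ 224 ∷ 256 ∷ 448 ∷ 480 ∷ 512 ∷ 896 ∷ 960 ∷ 1024 ∷ 1568 ∷ 1696 ∷ 1792 ∷ 1824 ∷ 1920 ∷ 2048 ∷ 2592 ∷ 2656 ∷ 2720 ∷ 3104 ∷ 3136 ∷ 3168 ∷ 3360 ∷ 3392 ∷ 3488 ∷ 3552 ∷ 3584 ∷ []

module Pell₁₆₅ = PellDescent 165 1079 84 26404 refl
module Pell₃₃₀ = PellDescent 330 109 6 26404 refl
module Residues₁₆₅ = Pell₁₆₅.Residues 738176
module Residues₃₃₀ = Pell₃₃₀.Residues 3616

module Invariant₁₆₅ = Residues₁₆₅.Invariant S₁₆₅ (toWitness {a? = Residues₁₆₅.closed? S₁₆₅} _)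
  294 (s≤s z≤n) (toWitness {a? = 84 * 84 * 26404 <? (2 * 1079 + 2) * (294 * 294)} _)
  (square-roots-below (λ W Y → (Y % 738176 , W % 738176) ∈? S₁₆₅) (λ W → 26404 + 165 * (W * W)) 294 _)

module Invariant₃₃₀ = Residues₃₃₀.Invariant S₃₃₀ (toWitness {a? = Residues₃₃₀.closed? S₃₃₀} _)
  66 (s≤s z≤n) (toWitness {a? = 6 * 6 * 26404 <? (2 * 109 + 2) * (66 * 66)} _)
  (square-roots-below (λ W Y → (Y % 3616 , W % 3616) ∈? S₃₃₀) (λ W → 26404 + 330 * (W * W)) 66 _)

pell₁₆₅-excludes-powers : ∀ x k → 7 ≤ k → x * x ≢ 26404 + 165 * (2 ^ k * 2 ^ k)
pell₁₆₅-excludes-powers = Invariant₁₆₅.no-solution-at-powers L₁₆₅ 2 7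
  (toWitness {a? = all? (λ (_ , w) → ¬? (w ∈ℕ? L₁₆₅)) S₁₆₅} _)
  (toWitness {a? = (2 ^ 7) % 738176 ∈ℕ? L₁₆₅} _)
  (All.lookup (toWitness {a? = all? (λ r → (2 * r) % 738176 ∈ℕ? L₁₆₅) L₁₆₅} _))

pell₃₃₀-excludes-powers : ∀ x k → 5 ≤ k → x * x ≢ 26404 + 330 * (2 ^ k * 2 ^ k)
pell₃₃₀-excludes-powers = Invariant₃₃₀.no-solution-at-powers L₃₃₀ 2 5
  (toWitness {a? = all? (λ (_ , w) → ¬? (w ∈ℕ? L₃₃₀)) S₃₃₀} _)
  (toWitness {a? = (2 ^ 5) % 3616 ∈ℕ? L₃₃₀} _)
  (All.lookup (toWitness {a? = all? (λ r → (2 * r) % 3616 ∈ℕ? L₃₃₀) L₃₃₀} _))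

equation₂-as-norm-equation : ∀ n →
  165 * 2 ^ n + 26404 ≡ 26404 + 165 * (2 ^ ⌊ n /2⌋ * 2 ^ ⌊ n /2⌋) ⊎
  165 * 2 ^ n + 26404 ≡ 26404 + 330 * (2 ^ ⌊ n /2⌋ * 2 ^ ⌊ n /2⌋)
equation₂-as-norm-equation n = Sum.map
  (λ 2ⁿ≡P² → trans (cong (λ t → 165 * t + 26404) {2 ^ n} {2 ^ ⌊ n /2⌋ * 2 ^ ⌊ n /2⌋} 2ⁿ≡P²)
                   (+-comm (165 * (2 ^ ⌊ n /2⌋ * 2 ^ ⌊ n /2⌋)) 26404))
  (λ 2ⁿ≡2P² → trans (cong (λ t → 165 * t + 26404) {2 ^ n} {2 * (2 ^ ⌊ n /2⌋ * 2 ^ ⌊ n /2⌋)} 2ⁿ≡2P²)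
                    (double (2 ^ ⌊ n /2⌋ * 2 ^ ⌊ n /2⌋) 26404))
  (power-of-two-split n)
  where
  double : ∀ X c → 165 * (2 * X) + c ≡ c + 330 * X
  double = solve-∀

equation₂-no-large-solution : ∀ x n → 16 ≤ n → x * x ≢ 165 * 2 ^ n + 26404
equation₂-no-large-solution x n 16≤n x²≡rhs = [
    (λ rhs≡ → pell₁₆₅-excludes-powers x ⌊ n /2⌋ (≤-trans (m≤m+n 7 1) (⌊n/2⌋-mono 16≤n)) (trans x²≡rhs rhs≡)) ,
    (λ rhs≡ → pell₃₃₀-excludes-powers x ⌊ n /2⌋ (≤-trans (m≤m+n 5 3) (⌊n/2⌋-mono 16≤n)) (trans x²≡rhs rhs≡)) ]′
  (equation₂-as-norm-equation n)

equation₂-complete : ∀ x n → x * x ≡ 165 * 2 ^ n + 26404 → (x , n) ∈ solutions₂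
equation₂-complete x n x²≡rhs with n <? 16
... | yes n<16 =
  square-roots-below (λ n x → (x , n) ∈? solutions₂) (λ n → 165 * 2 ^ n + 26404) 16 _ x n<16 x²≡rhs
... | no n≮16 = contradiction x²≡rhs (equation₂-no-large-solution x n (≮⇒≥ n≮16))

theorem2p4 : ((x n : ℕ) → (x ^ 2 ≡ 57 * 2 ^ n + 117440512) ⇔ ((x ≡ 10837 × n ≡ 0) ⊎ (x ≡ 10880 × n ≡ 14) ⊎ (x ≡ 11008 × n ≡ 16) ⊎ (x ≡ 13312 × n ≡ 20) ⊎ (x ≡ 32768 × n ≡ 24) ⊎ (x ≡ 45056 × n ≡ 25)))
    × ((x n : ℕ) → (x ^ 2 ≡ 165 * 2 ^ n + 26404) ⇔ ((x ≡ 163 × n ≡ 0) ⊎ (x ≡ 178 × n ≡ 5) ⊎ (x ≡ 218 × n ≡ 7) ⊎ (x ≡ 262 × n ≡ 8) ⊎ (x ≡ 442 × n ≡ 10) ⊎ (x ≡ 838 × n ≡ 12)))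
theorem2p4 =
  solutions-characterised (λ n → 57 * 2 ^ n + 117440512) solutions₁ equation₁-complete
    (refl All.∷ refl All.∷ refl All.∷ refl All.∷ refl All.∷ refl All.∷ All.[]) ,
  solutions-characterised (λ n → 165 * 2 ^ n + 26404) solutions₂ equation₂-complete
    (refl All.∷ refl All.∷ refl All.∷ refl All.∷ refl All.∷ refl All.∷ All.[])
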